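{- Let $\alpha\in\mathcal{C}_n$. Then: (i) for $i\in[n-1]$ and $i<j\leqslant n+1$, $c_{i,j}(\alpha^*)=j-i-1-c_{i,j}(\alpha)$; (ii) if $\alpha'\in\mathcal{C}_n$ and $\alpha$ covers $\alpha'$, then $(\alpha')^*$ covers $\alpha^*$.
   Context: $[n]=\{1,\dots,n\}$. A (weak) composition is a finite sequence of nonnegative integers $(\alpha_1,\dots,\alpha_m)$ with $\alpha_k=0$ for $k>m$; $|\alpha|=\sum\alpha_k$. $\mathcal{C}_n$ is the set of compositions $(\alpha_1,\dots,\alpha_{n-1})$ with $0\leqslant\alpha_i\leqslant n-i$. For $\alpha\in\mathcal{C}_n$, $\alpha^*\in\mathcal{C}_n$ is defined by $\alpha^*_i=n-i-\alpha_i$ for $i\in[n-1]$. For a composition $\alpha$, a positive integer $i$ and $j\in\mathbb{N}$: $c_{i,j}(\alpha)=0$ if $j\leqslant i+1$; for $j>i+1$, $c_{i,j}(\alpha)=c_{i,j-1}(\alpha)+1$ if $\alpha_{j-1}<\alpha_i-c_{i,j-1}(\alpha)$ and $c_{i,j}(\alpha)=c_{i,j-1}(\alpha)$ otherwise. For compositions with $|\alpha|=|\alpha'|+1$, $\alpha$ covers $\alpha'$ if there are positive integers $i<j$ with: (a1) $\alpha'_i\leqslant\alpha_i-1$; (a2) $\alpha'_j=\alpha_j+\alpha_i-\alpha'_i-1$; (a3) $\alpha'_k=\alpha_k$ for $k\neq i,j$; (a4) $c_{i,j}(\alpha)=c_{i,j}(\alpha')=\alpha'_i-\alpha_j$. 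-}

module Defs where

open import Data.Nat using (ℕ; zero; suc; _+_; _∸_; _≤_; _<_; _<ᵇ_)
open import Data.Integer using (ℤ; +_) renaming (_-_ to _-ℤ_; _+_ to _+ℤ_)
open import Data.List using (List; []; _∷_; length)
open import Data.Nat.ListAction using (sum)
open import Data.Bool using (if_then_else_)
open import Data.Product using (_×_; Σ; ∃-syntax)
open import Relation.Binary.PropositionalEquality using (_≡_; _≢_)

-- A (weak) composition is a finite list (α₁,…,αₘ); entries beyond the end are 0.
Composition : Set
Composition = List ℕ

-- 1-based lookup, 0 outside the list (so α 0 = 0 by convention, never used).
_!_ : Composition → ℕ → ℕ
[] ! k = 0
(a ∷ as) ! zero = 0
(a ∷ as) ! suc zero = a
(a ∷ as) ! suc (suc k) = as ! suc k

∣_∣ : Composition → ℕ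
∣ α ∣ = sum α

InC : ℕ → Composition → Set
InC n α = (length α ≡ n ∸ 1) × (∀ i → 1 ≤ i → i ≤ n ∸ 1 → α ! i ≤ n ∸ i)

star' : ℕ → ℕ → Composition → Composition
star' n i [] = []
star' n i (a ∷ as) = (n ∸ i ∸ a) ∷ star' n (suc i) as

star : ℕ → Composition → Composition
star n α = star' n 1 α

-- c_{i,j}(α); the test α_{j-1} < α_i - c_{i,j-1}(α) (in ℤ) is written
-- equivalently in ℕ as α_{j-1} + c_{i,j-1}(α) < α_i.
c : ℕ → ℕ → Composition → ℕ
c i zero α = 0
c i (suc j) α =
  if suc i <ᵇ suc j
  then (if (α ! j) + c i j α <ᵇ α ! i then suc (c i j α) else c i j α)
  else 0

Covers : Composition → Composition → Set
Covers α α' =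
  (∣ α ∣ ≡ suc ∣ α' ∣) ×
  ∃[ i ] ∃[ j ] (1 ≤ i × i < j ×
    (α' ! i ≤ α ! i ∸ 1) ×
    (+ (α' ! j) ≡ (+ (α ! j) +ℤ + (α ! i)) -ℤ + (α' ! i) -ℤ + 1) ×
    (∀ k → 1 ≤ k → k ≢ i → k ≢ j → α' ! k ≡ α ! k) ×
    (+ c i j α ≡ + (α' ! i) -ℤ + (α ! j)) ×
    (+ c i j α' ≡ + (α' ! i) -ℤ + (α ! j)))

module Submission where

-- Since α*ₖ + αₖ = n − k, the two tests αⱼ + c_{i,j}(α) < αᵢ and α*ⱼ + c_{i,j}(α*) < α*ᵢ
-- have sides summing to n − i − 1 and n − i as long as c_{i,j}(α) + c_{i,j}(α*) = j − i − 1,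
-- so exactly one of them succeeds: one of the two counters grows at each step, which is (i).
-- For (ii), |α*| + |α| depends only on n, and (a2), (a4) for ((α')*, α*) are linear consequences
-- of (a2), (a4) for (α, α') once αₖ* = n − k − αₖ and (i) are substituted. That needs j ≤ n,
-- which holds because c_{i,j}(α) + αⱼ = α'ᵢ < αᵢ whereas c_{i,k+1}(α) ≥ αᵢ − (n − k) for k ≥ i.

open import Defs
open import Data.Nat using (ℕ; zero; suc; _+_; _∸_; _≤_; _<_; _<ᵇ_; z≤n; s≤s; _≤?_; pred)
open import Data.Nat.Properties
open import Data.Nat.ListAction using (sum)
open import Data.List using ([]; _∷_; length; replicate)
open import Data.Bool using (true; false; not; if_then_else_)
open import Data.Empty using (⊥-elim)
open import Data.Sum using (inj₁; inj₂)
open import Data.Product using (_×_; _,_; proj₁)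
open import Relation.Nullary using (yes; no)
open import Relation.Nullary.Reflects using (invert)
open import Relation.Binary.PropositionalEquality
open import Algebra.Properties.CommutativeSemigroup +-commutativeSemigroup using (interchange)
open import Data.Integer using (ℤ; +_) renaming (_-_ to _-ℤ_; _+_ to _+ℤ_)
open import Data.Integer.Properties using (+-injective)
open import Data.Integer.Tactic.RingSolver using (solve-∀)
open import Data.Nat.Tactic.RingSolver using () renaming (solve-∀ to ℕ-solve-∀)

!-beyond-length : ∀ (α : Composition) k → length α ≤ k → α ! suc k ≡ 0
!-beyond-length [] k _ = refl
!-beyond-length (a ∷ []) (suc k) _ = refl
!-beyond-length (a ∷ b ∷ as) (suc k) (s≤s le) = !-beyond-length (b ∷ as) k le

InC⇒!≤ : ∀ {n} α → InC n α → ∀ k → α ! k ≤ n ∸ k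
InC⇒!≤ [] _ k = z≤n
InC⇒!≤ (a ∷ as) _ zero = z≤n
InC⇒!≤ {n} α (len , bounded) (suc k) with suc k ≤? n ∸ 1
... | yes in-range = bounded (suc k) (s≤s z≤n) in-range
... | no out-of-range rewrite !-beyond-length α k (subst (_≤ k) (sym len) (≤-pred (≰⇒> out-of-range))) = z≤n

star'-! : ∀ n s α k → n ≤ s + length α → star' n s α ! suc k ≡ n ∸ (s + k) ∸ α ! suc k
star'-! n s [] k n≤s+0 = sym (m≤n⇒m∸n≡0 (≤-trans n≤s+0 (+-monoʳ-≤ s z≤n)))
star'-! n s (a ∷ as) zero _ = cong (λ m → n ∸ m ∸ a) (sym (+-identityʳ s))
star'-! n s (a ∷ as) (suc k) le =
  trans (star'-! n (suc s) as k (subst (n ≤_) (+-suc s (length as)) le))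
        (cong (λ m → n ∸ m ∸ as ! suc k) (sym (+-suc s k)))

star-! : ∀ {n} α → InC n α → ∀ k → 1 ≤ k → star n α ! k ≡ n ∸ k ∸ α ! k
star-! {n} α (len , _) (suc k) _ = star'-! n 1 α k (subst (λ m → n ≤ 1 + m) (sym len) (m≤n+m∸n n 1))

star-!-+-! : ∀ {n} α → InC n α → ∀ k → 1 ≤ k → k ≤ n → star n α ! k + α ! k + k ≡ n
star-!-+-! α inc k 1≤k k≤n rewrite star-! α inc k 1≤k =
  trans (cong (_+ k) (m∸n+n≡m (InC⇒!≤ α inc k))) (m∸n+n≡m k≤n)

<ᵇ-irrefl : ∀ m → (m <ᵇ m) ≡ false
<ᵇ-irrefl m with m <ᵇ m | invert (<ᵇ-reflects-< m m)
... | true  | m<m = ⊥-elim (<-irrefl refl m<m)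
... | false | _   = refl

<ᵇ-complement : ∀ a b u v → suc (a + b) ≡ u + v → (a <ᵇ u) ≡ not (b <ᵇ v)
<ᵇ-complement a b u v e with a <ᵇ u | invert (<ᵇ-reflects-< a u) | b <ᵇ v | invert (<ᵇ-reflects-< b v)
... | true  | a<u | true  | b<v =
  ⊥-elim (1+n≰n (≤-trans (≤-reflexive (cong suc (sym (+-suc a b))))
                         (≤-trans (+-mono-≤ a<u b<v) (≤-reflexive (sym e)))))
... | false | a≮u | false | b≮v =
  ⊥-elim (1+n≰n (≤-trans (≤-reflexive e) (+-mono-≤ (≮⇒≥ a≮u) (≮⇒≥ b≮v))))
... | true  | _ | false | _ = refl
... | false | _ | true  | _ = refl

if-not-+-if : ∀ b x y → (if not b then suc x else x) + (if b then suc y else y) ≡ suc (x + y)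
if-not-+-if true  x y = +-suc x y
if-not-+-if false x y = refl

c-diag : ∀ i α → c i (suc i) α ≡ 0
c-diag i α rewrite <ᵇ-irrefl i = refl

c-suc : ∀ {i j} α → i < j →
  c i (suc j) α ≡ (if α ! j + c i j α <ᵇ α ! i then suc (c i j α) else c i j α)
c-suc {i} {j} α i<j with i <ᵇ j | invert (<ᵇ-reflects-< i j)
... | true  | _   = refl
... | false | i≮j = ⊥-elim (i≮j i<j)

complementary-tests : ∀ {n} α → InC n α → ∀ {i j} → 1 ≤ i → i < j → j ≤ n →
  c i j (star n α) + c i j α + 1 + i ≡ j →
  suc (star n α ! j + c i j (star n α) + (α ! j + c i j α)) ≡ star n α ! i + α ! i
complementary-tests {n} α inc {i} {j} 1≤i i<j j≤n counters = +-cancelʳ-≡ i _ _ (begin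
  suc (star n α ! j + c i j (star n α) + (α ! j + c i j α)) + i
    ≡⟨ regroup (star n α ! j) (α ! j) (c i j (star n α)) (c i j α) i ⟩
  star n α ! j + α ! j + (c i j (star n α) + c i j α + 1 + i)
    ≡⟨ cong (λ m → star n α ! j + α ! j + m) counters ⟩
  star n α ! j + α ! j + j
    ≡⟨ star-!-+-! α inc j (≤-trans 1≤i (<⇒≤ i<j)) j≤n ⟩
  n
    ≡⟨ star-!-+-! α inc i 1≤i (≤-trans (<⇒≤ i<j) j≤n) ⟨
  star n α ! i + α ! i + i ∎)
  where
  open ≡-Reasoning
  regroup : ∀ u x c* c i → suc (u + c* + (x + c)) + i ≡ u + x + (c* + c + 1 + i)
  regroup = ℕ-solve-∀

c-star-+-c-step : ∀ {n} α → InC n α → ∀ {i j} → 1 ≤ i → i < j → j ≤ n →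
  c i j (star n α) + c i j α + 1 + i ≡ j →
  c i (suc j) (star n α) + c i (suc j) α + 1 + i ≡ suc j
c-star-+-c-step {n} α inc {i} {j} 1≤i i<j j≤n counters
  rewrite c-suc (star n α) i<j | c-suc α i<j
        | <ᵇ-complement (star n α ! j + c i j (star n α)) (α ! j + c i j α)
                        (star n α ! i) (α ! i) (complementary-tests α inc 1≤i i<j j≤n counters)
        | if-not-+-if (α ! j + c i j α <ᵇ α ! i) (c i j (star n α)) (c i j α) = cong suc counters

c-star-+-c : ∀ {n} α → InC n α → ∀ {i j} → 1 ≤ i → i < j → j ≤ suc n →
  c i j (star n α) + c i j α + 1 + i ≡ j
c-star-+-c {n} α inc {i} {suc j} 1≤i i<1+j 1+j≤1+n with m≤n⇒m<n∨m≡n (≤-pred i<1+j)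
... | inj₂ refl rewrite c-diag i (star n α) | c-diag i α = refl
... | inj₁ i<j = c-star-+-c-step α inc 1≤i i<j (≤-pred 1+j≤1+n)
                   (c-star-+-c α inc 1≤i i<j (m≤n⇒m≤1+n (≤-pred 1+j≤1+n)))

x+y+z≡n⇒x≡n-z-y : ∀ {x y z n} → x + y + z ≡ n → + x ≡ + n -ℤ + z -ℤ + y
x+y+z≡n⇒x≡n-z-y {x} {y} {z} refl = cancel (+ x) (+ y) (+ z)
  where
  cancel : ∀ x y z → x ≡ x +ℤ y +ℤ z -ℤ z -ℤ y
  cancel = solve-∀

x+y+z+w≡n⇒x≡n-w-z-y : ∀ {x y z w n} → x + y + z + w ≡ n → + x ≡ + n -ℤ + w -ℤ + z -ℤ + y
x+y+z+w≡n⇒x≡n-w-z-y {x} {y} {z} {w} refl = cancel (+ x) (+ y) (+ z) (+ w)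
  where
  cancel : ∀ x y z w → x ≡ x +ℤ y +ℤ z +ℤ w -ℤ w -ℤ z -ℤ y
  cancel = solve-∀

x≡y-z⇒x+z≡y : ∀ {x y z : ℤ} → x ≡ y -ℤ z → x +ℤ z ≡ y
x≡y-z⇒x+z≡y {y = y} {z} refl = cancel y z
  where
  cancel : ∀ y z → y -ℤ z +ℤ z ≡ y
  cancel = solve-∀

c-star : ∀ {n} α → InC n α → ∀ {i j} → 1 ≤ i → i < j → j ≤ suc n →
  + c i j (star n α) ≡ + j -ℤ + i -ℤ + 1 -ℤ + c i j α
c-star α inc 1≤i i<j j≤1+n = x+y+z+w≡n⇒x≡n-w-z-y (c-star-+-c α inc 1≤i i<j j≤1+n)

!≤c+∸ : ∀ {n} α → InC n α → ∀ {i k} → i ≤ k → α ! i ≤ c i (suc k) α + (n ∸ k)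
!≤c+∸ α inc {i} i≤k with m≤n⇒m<n∨m≡n i≤k
... | inj₂ refl rewrite c-diag i α = InC⇒!≤ α inc i
!≤c+∸ {n} α inc {i} {suc k} _ | inj₁ i<1+k rewrite c-suc α i<1+k
  with α ! suc k + c i (suc k) α <ᵇ α ! i | invert (<ᵇ-reflects-< (α ! suc k + c i (suc k) α) (α ! i))
... | true | _ = begin
  α ! i                               ≤⟨ !≤c+∸ α inc (≤-pred i<1+k) ⟩
  c i (suc k) α + (n ∸ k)             ≤⟨ +-monoʳ-≤ (c i (suc k) α) (m≤n+m∸n (n ∸ k) 1) ⟩
  c i (suc k) α + suc (pred (n ∸ k))  ≡⟨ +-suc (c i (suc k) α) _ ⟩
  suc (c i (suc k) α + pred (n ∸ k))  ≡⟨ cong (λ m → suc (c i (suc k) α + m)) (pred[m∸n]≡m∸[1+n] n k) ⟩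
  suc (c i (suc k) α + (n ∸ suc k))   ∎
  where open ≤-Reasoning
... | false | test-fails = begin
  α ! i                               ≤⟨ ≮⇒≥ test-fails ⟩
  α ! suc k + c i (suc k) α           ≤⟨ +-monoˡ-≤ (c i (suc k) α) (InC⇒!≤ α inc (suc k)) ⟩
  n ∸ suc k + c i (suc k) α           ≡⟨ +-comm (n ∸ suc k) _ ⟩
  c i (suc k) α + (n ∸ suc k)         ∎
  where open ≤-Reasoning

c+!<!⇒≤ : ∀ {n} α → InC n α → ∀ {i j} → i < j → c i j α + α ! j < α ! i → j ≤ n
c+!<!⇒≤ {n} α inc {i} {j} i<j c+αⱼ<αᵢ with j ≤? n
... | yes j≤n = j≤n
c+!<!⇒≤ {n} α inc {i} {suc k} i<j c+αⱼ<αᵢ | no j≰n = ⊥-elim (<⇒≱ c+αⱼ<αᵢ (begin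
  α ! i                        ≤⟨ !≤c+∸ α inc (≤-pred i<j) ⟩
  c i (suc k) α + (n ∸ k)      ≡⟨ cong (λ m → c i (suc k) α + m) n∸k≡αₖ₊₁ ⟩
  c i (suc k) α + α ! suc k    ∎))
  where
  open ≤-Reasoning
  n≤k : n ≤ k
  n≤k = ≤-pred (≰⇒> j≰n)
  n∸k≡αₖ₊₁ : n ∸ k ≡ α ! suc k
  n∸k≡αₖ₊₁ = trans (m≤n⇒m∸n≡0 n≤k)
    (sym (!-beyond-length α k (subst (_≤ k) (sym (proj₁ inc)) (≤-trans (m∸n≤m n 1) n≤k))))

sum-star'-+-sum : ∀ n s α → (∀ k → α ! suc k ≤ n ∸ (s + k)) →
  sum (star' n s α) + sum α ≡ sum (star' n s (replicate (length α) 0))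
sum-star'-+-sum n s [] _ = refl
sum-star'-+-sum n s (a ∷ as) bounded = begin
  n ∸ s ∸ a + sum (star' n (suc s) as) + (a + sum as)
    ≡⟨ interchange (n ∸ s ∸ a) _ a _ ⟩
  n ∸ s ∸ a + a + (sum (star' n (suc s) as) + sum as)
    ≡⟨ cong₂ _+_ (m∸n+n≡m a≤n∸s) (sum-star'-+-sum n (suc s) as bounded-as) ⟩
  n ∸ s + sum (star' n (suc s) (replicate (length as) 0)) ∎
  where
  open ≡-Reasoning
  a≤n∸s : a ≤ n ∸ s
  a≤n∸s = subst (λ m → a ≤ n ∸ m) (+-identityʳ s) (bounded 0)
  bounded-as : ∀ k → as ! suc k ≤ n ∸ (suc s + k)
  bounded-as k = subst (λ m → as ! suc k ≤ n ∸ m) (+-suc s k) (bounded (suc k))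

∣star∣+∣∣ : ∀ {n} α → InC n α → ∣ star n α ∣ + ∣ α ∣ ≡ ∣ star n (replicate (n ∸ 1) 0) ∣
∣star∣+∣∣ {n} α inc = trans (sum-star'-+-sum n 1 α (λ k → InC⇒!≤ α inc (suc k)))
                             (cong (λ m → ∣ star n (replicate m 0) ∣) (proj₁ inc))

∣star∣-suc : ∀ {n} α α' → InC n α → InC n α' → ∣ α ∣ ≡ suc ∣ α' ∣ → ∣ star n α' ∣ ≡ suc ∣ star n α ∣
∣star∣-suc {n} α α' inc inc' ∣α∣≡1+∣α'∣ = +-cancelʳ-≡ (sum α') _ _ (begin
  sum (star n α') + sum α'      ≡⟨ trans (∣star∣+∣∣ α' inc') (sym (∣star∣+∣∣ α inc)) ⟩
  sum (star n α) + sum α        ≡⟨ cong (λ m → sum (star n α) + m) ∣α∣≡1+∣α'∣ ⟩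
  sum (star n α) + suc (sum α') ≡⟨ +-suc (sum (star n α)) (sum α') ⟩
  suc (sum (star n α)) + sum α' ∎)
  where open ≡-Reasoning

+x≡+y-+z⇒x+z≡y : ∀ {x y z} → + x ≡ + y -ℤ + z → x + z ≡ y
+x≡+y-+z⇒x+z≡y {y = y} {z} e = +-injective (x≡y-z⇒x+z≡y {y = + y} {+ z} e)

+x≡+y-+z-+w⇒x+w+z≡y : ∀ {x y z w} → + x ≡ + y -ℤ + z -ℤ + w → x + w + z ≡ y
+x≡+y-+z-+w⇒x+w+z≡y {y = y} {z} {w} e =
  +-injective (x≡y-z⇒x+z≡y {y = + y} {+ z} (x≡y-z⇒x+z≡y {y = + y -ℤ + z} {+ w} e))

-- (a1)–(a4) are the conditions of Covers, in order; a, b, a*, b* stand for entries of α, α', α*, α'*.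
a2-dual : ∀ n i j aᵢ aⱼ bᵢ {bⱼ a*ᵢ a*ⱼ b*ᵢ b*ⱼ : ℤ} →
  a*ᵢ ≡ n -ℤ i -ℤ aᵢ → a*ⱼ ≡ n -ℤ j -ℤ aⱼ → b*ᵢ ≡ n -ℤ i -ℤ bᵢ → b*ⱼ ≡ n -ℤ j -ℤ bⱼ →
  bⱼ ≡ (aⱼ +ℤ aᵢ) -ℤ bᵢ -ℤ + 1 →
  a*ⱼ ≡ (b*ⱼ +ℤ b*ᵢ) -ℤ a*ᵢ -ℤ + 1
a2-dual n i j aᵢ aⱼ bᵢ refl refl refl refl refl = identity n i j aᵢ aⱼ bᵢ (+ 1)
  where
  identity : ∀ n i j aᵢ aⱼ bᵢ o →
    n -ℤ j -ℤ aⱼ ≡ ((n -ℤ j -ℤ ((aⱼ +ℤ aᵢ) -ℤ bᵢ -ℤ o)) +ℤ (n -ℤ i -ℤ bᵢ)) -ℤ (n -ℤ i -ℤ aᵢ) -ℤ o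
  identity = solve-∀

a4-dual : ∀ n i j aᵢ aⱼ bᵢ {bⱼ a*ᵢ b*ⱼ cᵢⱼ c*ᵢⱼ : ℤ} →
  a*ᵢ ≡ n -ℤ i -ℤ aᵢ → b*ⱼ ≡ n -ℤ j -ℤ bⱼ → bⱼ ≡ (aⱼ +ℤ aᵢ) -ℤ bᵢ -ℤ + 1 →
  cᵢⱼ ≡ bᵢ -ℤ aⱼ → c*ᵢⱼ ≡ j -ℤ i -ℤ + 1 -ℤ cᵢⱼ →
  c*ᵢⱼ ≡ a*ᵢ -ℤ b*ⱼ
a4-dual n i j aᵢ aⱼ bᵢ refl refl refl refl refl = identity n i j aᵢ aⱼ bᵢ (+ 1)
  where
  identity : ∀ n i j aᵢ aⱼ bᵢ o →
    j -ℤ i -ℤ o -ℤ (bᵢ -ℤ aⱼ) ≡ (n -ℤ i -ℤ aᵢ) -ℤ (n -ℤ j -ℤ ((aⱼ +ℤ aᵢ) -ℤ bᵢ -ℤ o))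
  identity = solve-∀

covered-entry-< : ∀ {aᵢ aⱼ bᵢ bⱼ cᵢⱼ} → bᵢ ≤ aᵢ ∸ 1 → cᵢⱼ + aⱼ ≡ bᵢ → bⱼ + 1 + bᵢ ≡ aⱼ + aᵢ → bᵢ < aᵢ
covered-entry-< {suc aᵢ} bᵢ≤aᵢ _ _ = s≤s bᵢ≤aᵢ
covered-entry-< {zero} {bⱼ = bⱼ} {cᵢⱼ} z≤n c+aⱼ≡0 e with m+n≡0⇒n≡0 cᵢⱼ c+aⱼ≡0
... | refl with m+n≡0⇒n≡0 bⱼ (m+n≡0⇒m≡0 (bⱼ + 1) e)
... | ()

star-reverses-Covers : ∀ {n} α α' → InC n α → InC n α' → Covers α α' → Covers (star n α') (star n α)
star-reverses-Covers {n} α α' inc inc' (∣α∣≡1+∣α'∣ , i , j , 1≤i , i<j , a1 , a2 , a3 , a4 , a4') =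
  ∣star∣-suc α α' inc inc' ∣α∣≡1+∣α'∣ , i , j , 1≤i , i<j , a1* , a2* , a3* , a4* α' inc' a4' , a4* α inc a4
  where
  a4ℕ : c i j α + α ! j ≡ α' ! i
  a4ℕ = +x≡+y-+z⇒x+z≡y a4
  α'ᵢ<αᵢ : α' ! i < α ! i
  α'ᵢ<αᵢ = covered-entry-< a1 a4ℕ (+x≡+y-+z-+w⇒x+w+z≡y a2)
  j≤n : j ≤ n
  j≤n = c+!<!⇒≤ α inc i<j (subst (_< α ! i) (sym a4ℕ) α'ᵢ<αᵢ)
  1≤j : 1 ≤ j
  1≤j = ≤-trans 1≤i (<⇒≤ i<j)
  i≤n : i ≤ n
  i≤n = ≤-trans (<⇒≤ i<j) j≤n
  complement : ∀ β → InC n β → ∀ k → 1 ≤ k → k ≤ n → + (star n β ! k) ≡ + n -ℤ + k -ℤ + (β ! k)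
  complement β incβ k 1≤k k≤n = x+y+z≡n⇒x≡n-z-y (star-!-+-! β incβ k 1≤k k≤n)
  a1* : star n α ! i ≤ star n α' ! i ∸ 1
  a1* rewrite star-! α inc i 1≤i | star-! α' inc' i 1≤i = <⇒≤pred (∸-monoʳ-< α'ᵢ<αᵢ (InC⇒!≤ α inc i))
  a2* : + (star n α ! j) ≡ (+ (star n α' ! j) +ℤ + (star n α' ! i)) -ℤ + (star n α ! i) -ℤ + 1
  a2* = a2-dual (+ n) (+ i) (+ j) (+ (α ! i)) (+ (α ! j)) (+ (α' ! i))
          (complement α inc i 1≤i i≤n) (complement α inc j 1≤j j≤n)
          (complement α' inc' i 1≤i i≤n) (complement α' inc' j 1≤j j≤n) a2
  a3* : ∀ k → 1 ≤ k → k ≢ i → k ≢ j → star n α ! k ≡ star n α' ! k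
  a3* k 1≤k k≢i k≢j rewrite star-! α inc k 1≤k | star-! α' inc' k 1≤k =
    cong (λ m → n ∸ k ∸ m) (sym (a3 k 1≤k k≢i k≢j))
  a4* : ∀ β → InC n β → + c i j β ≡ + (α' ! i) -ℤ + (α ! j) →
    + c i j (star n β) ≡ + (star n α ! i) -ℤ + (star n α' ! j)
  a4* β incβ cᵢⱼ = a4-dual (+ n) (+ i) (+ j) (+ (α ! i)) (+ (α ! j)) (+ (α' ! i))
    (complement α inc i 1≤i i≤n) (complement α' inc' j 1≤j j≤n) a2 cᵢⱼ
    (c-star β incβ 1≤i i<j (m≤n⇒m≤1+n j≤n))

lemma3p8 : (n : ℕ) (α : Composition) → InC n α →
    ((i j : ℕ) → 1 ≤ i → i ≤ n ∸ 1 → i < j → j ≤ n + 1 →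
    + c i j (star n α) ≡ + j -ℤ + i -ℤ + 1 -ℤ + c i j α)
    × ((α' : Composition) → InC n α' → Covers α α' →
    Covers (star n α') (star n α))
lemma3p8 n α inc =
  (λ i j 1≤i _ i<j j≤n+1 → c-star α inc 1≤i i<j (subst (j ≤_) (+-comm n 1) j≤n+1)) ,
  (λ α' inc' → star-reverses-Covers α α' inc inc')
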